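{- Let $k\geq 2$. Let $\mathcal{A}=(a_1,a_2,\ldots,a_k)_{\bar r}$ be a finite sequence of integers, where $0=a_1<a_2<\cdots<a_k$ and $\bar r=(r_1,\ldots,r_k)$ with $r_i\geq 1$ for all $i$. Let $0\leq\alpha\leq \sum_{i=1}^k r_i-1$. Then there exists an integer $m\in[1,k]$ with $\sum_{i=1}^{m-1} r_i\leq \alpha<\sum_{i=1}^m r_i$, and \[|\Sigma_{\alpha}(\bar r,\mathcal{A})|\geq \sum_{i=1}^k (i-1) r_i-\sum_{i=1}^m (i-1) r_i+(m-1)\left(\sum_{i=1}^m r_i-\alpha\right)+1.\] Moreover, this lower bound is best possible, i.e., for given $k,\bar r,\alpha$ it is attained by some such sequence.
   Context: For distinct integers $a_1,\ldots,a_k$ and $\bar r=(r_1,\ldots,r_k)$ with $r_i\geq 1$, $(a_1,\ldots,a_k)_{\bar r}$ denotes the finite sequence consisting of $r_i$ copies of $a_i$ for each $i$. For such a sequence $\mathcal{A}$ and an integer $0\leq\alpha\leq\sum_i r_i$, $\Sigma_{\alpha}(\bar r,\mathcal{A})$ is the set of sums $s(\mathcal{B})$ of all terms of $\mathcal{B}$, over all subsequences $\mathcal{B}$ of $\mathcal{A}$ of length at least $\alpha$ (the empty subsequence has sum $0$). For integers $a\leq b$, $[a,b]=\{a,\ldots,b\}$; empty sums are $0$. -}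

module Defs where

open import Data.Nat using (ℕ; zero; suc; _+_; _*_; _∸_; _≤_; _<_)
open import Data.Integer as ℤ using (ℤ; 0ℤ)
open import Data.List using (List; []; _∷_; _++_; replicate; length; foldr)
open import Data.List.Relation.Binary.Sublist.Propositional using (_⊆_)
open import Data.List.Relation.Unary.Unique.Propositional using (Unique)
open import Data.List.Relation.Unary.All using (All)
open import Data.List.Membership.Propositional using (_∈_)
open import Data.Product using (Σ; _×_; ∃)
open import Relation.Binary.PropositionalEquality using (_≡_)

-- Sequences are 1-indexed: a i, r i for i ∈ [1,k]; values at other indices are irrelevant.

sumTo : (ℕ → ℕ) → ℕ → ℕ
sumTo f zero = 0
sumTo f (suc n) = sumTo f n + f (suc n)

sumℤ : List ℤ → ℤ
sumℤ = foldr ℤ._+_ 0ℤ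

seqOf : (ℕ → ℤ) → (ℕ → ℕ) → ℕ → List ℤ
seqOf a r zero = []
seqOf a r (suc n) = seqOf a r n ++ replicate (r (suc n)) (a (suc n))

InSigma : ℕ → List ℤ → ℤ → Set
InSigma α A s = Σ (List ℤ) λ B → B ⊆ A × α ≤ length B × sumℤ B ≡ s

CardAtLeast : (ℤ → Set) → ℕ → Set
CardAtLeast S N = Σ (List ℤ) λ xs → Unique xs × length xs ≡ N × All S xs

CardEq : (ℤ → Set) → ℕ → Set
CardEq S N = Σ (List ℤ) λ xs → Unique xs × length xs ≡ N × All S xs × (∀ s → S s → s ∈ xs)

ValidA : ℕ → (ℕ → ℤ) → Set
ValidA k a = a 1 ≡ 0ℤ × (∀ i → 1 ≤ i → i < k → a i ℤ.< a (suc i))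

bound : ℕ → (ℕ → ℕ) → ℕ → ℕ → ℕ
bound k r α m =
  (sumTo (λ i → (i ∸ 1) * r i) k ∸ sumTo (λ i → (i ∸ 1) * r i) m)
  + (m ∸ 1) * (sumTo r m ∸ α) + 1

module Submission where

-- A configuration c : ℕ → ℕ with c j ≤ r j describes the subsequence (a_1,...,a_k)_c of
-- A = (a_1,...,a_k)_r̄; its length is Σ c j and its sum is the weight Σ c j a_j.  We also
-- use its height Σ (j-1) c j.  The lower bound comes from a walk through configurations
-- of length ≥ α along which the height rises by exactly one per step and the weight rises
-- strictly (as 0 = a_1 < ... < a_k): below the height of r̄ some index j ≥ 2 is
-- unsaturated (c j < r j); at the least such j either add a copy of a_2 (j = 2), or move
-- one copy from the saturated, hence nonempty, index j-1 to j.  Starting from the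
-- configuration of the first α terms, of height Σ_{i<m}(i-1)r_i + (m-1)(α - Σ_{i<m} r_i),
-- the walk takes bound - 1 steps to reach r̄, which yields `bound` distinct sums.
-- For a_j = j - 1 weight and height coincide, so the walk meets every integer between
-- its two end heights, while every subsequence with ≥ α terms has its sum in that range
-- (at least the sum of the first α terms, at most the total): the bound is attained.

open import Defs
open import Algebra.Bundles using (CommutativeMonoid)
open import Data.Nat as ℕ
  using (ℕ; zero; suc; pred; _+_; _*_; _∸_; _≤_; _<_; z≤n; s≤s; _≟_; _≤?_; _<?_; >-nonZero)
open import Data.Nat.Properties
open import Data.Nat.Solver using (module +-*-Solver)
open import Data.Integer as ℤ using (ℤ; 0ℤ; +_)
  renaming (_+_ to _+ᶻ_; _*_ to _*ᶻ_; _≤_ to _≤ᶻ_; _<_ to _<ᶻ_)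
import Data.Integer.Properties as ℤP
open import Data.List using (List; []; _∷_; _++_; replicate; length; take)
import Data.List.Properties as ListP
open import Data.List.Relation.Binary.Sublist.Propositional using (_⊆_; []; _∷_; _∷ʳ_)
import Data.List.Relation.Binary.Sublist.Heterogeneous.Properties as SublistP
open import Data.List.Relation.Binary.Sublist.Propositional.Properties using (All-resp-⊆)
open import Data.List.Relation.Unary.All as All using (All; []; _∷_)
import Data.List.Relation.Unary.All.Properties as AllP
open import Data.List.Relation.Unary.AllPairs using (AllPairs; []; _∷_)
import Data.List.Relation.Unary.AllPairs.Properties as AllPairsP
open import Data.List.Relation.Unary.Unique.Propositional using (Unique)
open import Data.List.Membership.Propositional using (_∈_)
open import Data.List.Relation.Unary.Any using (here; there)
open import Data.Product using (Σ; _×_; _,_)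
open import Data.Sum using (_⊎_; inj₁; inj₂)
open import Data.Empty using (⊥-elim)
open import Function using (case_of_)
open import Relation.Nullary using (yes; no)
open import Relation.Binary.PropositionalEquality

module RangeSum {c ℓ} (M : CommutativeMonoid c ℓ) where
  open CommutativeMonoid M
    using (Carrier; _≈_; _∙_; ε; ∙-cong; assoc; commutativeSemigroup)
    renaming (setoid to carrierSetoid)
  open import Relation.Binary.Reasoning.Setoid carrierSetoid
  open import Algebra.Properties.CommutativeSemigroup commutativeSemigroup using (xy∙z≈xz∙y)

  ∑ : (ℕ → Carrier) → ℕ → Carrier
  ∑ f zero    = ε
  ∑ f (suc n) = ∑ f n ∙ f (suc n)

  ∑-cong : ∀ {f g} n → (∀ j → 1 ≤ j → j ≤ n → f j ≈ g j) → ∑ f n ≈ ∑ g n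
  ∑-cong zero    f≈g = CommutativeMonoid.refl M
  ∑-cong (suc n) f≈g =
    ∙-cong (∑-cong n (λ j 1≤j j≤n → f≈g j 1≤j (m≤n⇒m≤1+n j≤n))) (f≈g (suc n) (s≤s z≤n) ≤-refl)

  ∑-bump : ∀ {f g} x {p} n → 1 ≤ p → p ≤ n →
           (∀ j → j ≢ p → g j ≈ f j) → g p ≈ f p ∙ x → ∑ g n ≈ ∑ f n ∙ x
  ∑-bump x zero (s≤s _) ()
  ∑-bump {f} {g} x {p} (suc n) 1≤p p≤1+n off at with p ≟ suc n
  ... | yes refl = begin
    ∑ g n ∙ g (suc n)        ≈⟨ ∙-cong (∑-cong n (λ j _ j≤n → off j (<⇒≢ (s≤s j≤n)))) at ⟩
    ∑ f n ∙ (f (suc n) ∙ x)  ≈⟨ assoc (∑ f n) (f (suc n)) x ⟨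
    ∑ f n ∙ f (suc n) ∙ x    ∎
  ... | no p≢1+n = begin
    ∑ g n ∙ g (suc n)        ≈⟨ ∙-cong (∑-bump x n 1≤p (≤-pred (≤∧≢⇒< p≤1+n p≢1+n)) off at)
                                       (off (suc n) (≢-sym p≢1+n)) ⟩
    ∑ f n ∙ x ∙ f (suc n)    ≈⟨ xy∙z≈xz∙y (∑ f n) x (f (suc n)) ⟩
    ∑ f n ∙ f (suc n) ∙ x    ∎

open RangeSum +-0-commutativeMonoid using () renaming (∑ to ∑ℕ; ∑-bump to ∑ℕ-bump)
open RangeSum ℤP.+-0-commutativeMonoid using () renaming (∑ to ∑ℤ; ∑-bump to ∑ℤ-bump)

sumTo≡∑ℕ : ∀ f n → sumTo f n ≡ ∑ℕ f n
sumTo≡∑ℕ f zero    = refl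
sumTo≡∑ℕ f (suc n) = cong (_+ f (suc n)) (sumTo≡∑ℕ f n)

sumTo-bump : ∀ {f g} x {p} n → 1 ≤ p → p ≤ n →
             (∀ j → j ≢ p → g j ≡ f j) → g p ≡ f p + x → sumTo g n ≡ sumTo f n + x
sumTo-bump {f} {g} x n 1≤p p≤n off at = begin
  sumTo g n      ≡⟨ sumTo≡∑ℕ g n ⟩
  ∑ℕ g n         ≡⟨ ∑ℕ-bump x n 1≤p p≤n off at ⟩
  ∑ℕ f n + x     ≡⟨ cong (_+ x) (sumTo≡∑ℕ f n) ⟨
  sumTo f n + x  ∎
  where open ≡-Reasoning

sumTo-cong : ∀ {f g} n → (∀ j → 1 ≤ j → j ≤ n → f j ≡ g j) → sumTo f n ≡ sumTo g n
sumTo-cong zero    f≡g = refl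
sumTo-cong (suc n) f≡g =
  cong₂ _+_ (sumTo-cong n (λ j 1≤j j≤n → f≡g j 1≤j (m≤n⇒m≤1+n j≤n))) (f≡g (suc n) (s≤s z≤n) ≤-refl)

sumTo-mono : ∀ {f g} n → (∀ j → 1 ≤ j → j ≤ n → f j ≤ g j) → sumTo f n ≤ sumTo g n
sumTo-mono zero    f≤g = z≤n
sumTo-mono (suc n) f≤g =
  +-mono-≤ (sumTo-mono n (λ j 1≤j j≤n → f≤g j 1≤j (m≤n⇒m≤1+n j≤n))) (f≤g (suc n) (s≤s z≤n) ≤-refl)

sumTo-≤ : ∀ f {m n} → m ≤ n → sumTo f m ≤ sumTo f n
sumTo-≤ f {n = zero}  z≤n = ≤-refl
sumTo-≤ f {m} {suc n} m≤1+n with m≤n⇒m<n∨m≡n m≤1+n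
... | inj₁ (s≤s m≤n) = ≤-trans (sumTo-≤ f m≤n) (m≤m+n (sumTo f n) _)
... | inj₂ refl      = ≤-refl

sumTo-tail : ∀ f {m n} → (∀ j → m < j → f j ≡ 0) → m ≤ n → sumTo f n ≡ sumTo f m
sumTo-tail f {n = zero}  _    z≤n = refl
sumTo-tail f {m} {suc n} vanish m≤1+n with m≤n⇒m<n∨m≡n m≤1+n
... | inj₁ (s≤s m≤n) =
  trans (cong₂ _+_ (sumTo-tail f vanish m≤n) (vanish (suc n) (s≤s m≤n))) (+-identityʳ _)
... | inj₂ refl      = refl

Config : Set
Config = ℕ → ℕ

height : ℕ → Config → ℕ
height n c = sumTo (λ j → (j ∸ 1) * c j) n

weight : (ℕ → ℤ) → Config → ℕ → ℤ
weight a c n = ∑ℤ (λ j → + c j *ᶻ a j) n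

Bumped : ℕ → Config → Config → Set
Bumped p c c' = (∀ j → j ≢ p → c' j ≡ c j) × c' p ≡ suc (c p)

size-bump : ∀ {p n c c'} → 1 ≤ p → p ≤ n → Bumped p c c' → sumTo c' n ≡ sumTo c n + 1
size-bump 1≤p p≤n (off , at) =
  sumTo-bump 1 _ 1≤p p≤n off (trans at (+-comm 1 _))

height-bump : ∀ {p n c c'} → 1 ≤ p → p ≤ n → Bumped p c c' → height n c' ≡ height n c + (p ∸ 1)
height-bump {p} {c = c} 1≤p p≤n (off , at) =
  sumTo-bump (p ∸ 1) _ 1≤p p≤n (λ j j≢p → cong ((j ∸ 1) *_) (off j j≢p))
    (trans (cong ((p ∸ 1) *_) at) (trans (*-suc (p ∸ 1) (c p)) (+-comm (p ∸ 1) _)))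

weight-bump : ∀ a {p n c c'} → 1 ≤ p → p ≤ n → Bumped p c c' → weight a c' n ≡ weight a c n +ᶻ a p
weight-bump a {p} {c = c} 1≤p p≤n (off , at) =
  ∑ℤ-bump (a p) _ 1≤p p≤n (λ j j≢p → cong (λ v → + v *ᶻ a j) (off j j≢p))
    (trans (cong (λ v → + v *ᶻ a p) at) (trans (ℤP.suc-* (+ c p) (a p)) (ℤP.+-comm (a p) _)))

setAt : Config → ℕ → ℕ → Config
setAt c p v j with j ≟ p
... | yes _ = v
... | no _  = c j

setAt-here : ∀ c p v → setAt c p v p ≡ v
setAt-here c p v with p ≟ p
... | yes _   = refl
... | no p≢p  = ⊥-elim (p≢p refl)

setAt-elsewhere : ∀ c {p} v {j} → j ≢ p → setAt c p v j ≡ c j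
setAt-elsewhere c {p} v {j} j≢p with j ≟ p
... | yes j≡p = ⊥-elim (j≢p j≡p)
... | no _    = refl

raise lower : Config → ℕ → Config
raise c p = setAt c p (suc (c p))
lower c p = setAt c p (pred (c p))

raise-bumps : ∀ c p → Bumped p c (raise c p)
raise-bumps c p = (λ j j≢p → setAt-elsewhere c _ j≢p) , setAt-here c p _

lower-bumps : ∀ c p → 1 ≤ c p → Bumped p (lower c p) c
lower-bumps c p 1≤cp =
    (λ j j≢p → sym (setAt-elsewhere c _ j≢p))
  , sym (trans (cong suc (setAt-here c p _)) (suc-pred (c p) {{>-nonZero 1≤cp}}))

sumℤ-++ : ∀ xs ys → sumℤ (xs ++ ys) ≡ sumℤ xs +ᶻ sumℤ ys
sumℤ-++ []       ys = sym (ℤP.+-identityˡ _)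
sumℤ-++ (x ∷ xs) ys = trans (cong (x +ᶻ_) (sumℤ-++ xs ys)) (sym (ℤP.+-assoc x _ _))

sumℤ-replicate : ∀ t x → sumℤ (replicate t x) ≡ + t *ᶻ x
sumℤ-replicate zero    x = sym (ℤP.*-zeroˡ x)
sumℤ-replicate (suc t) x = trans (cong (x +ᶻ_) (sumℤ-replicate t x)) (sym (ℤP.suc-* (+ t) x))

sumℤ-seqOf : ∀ a c n → sumℤ (seqOf a c n) ≡ weight a c n
sumℤ-seqOf a c zero    = refl
sumℤ-seqOf a c (suc n) =
  trans (sumℤ-++ (seqOf a c n) _) (cong₂ _+ᶻ_ (sumℤ-seqOf a c n) (sumℤ-replicate (c (suc n)) (a (suc n))))

length-seqOf : ∀ a c n → length (seqOf a c n) ≡ sumTo c n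
length-seqOf a c zero    = refl
length-seqOf a c (suc n) =
  trans (ListP.length-++ (seqOf a c n)) (cong₂ _+_ (length-seqOf a c n) (ListP.length-replicate (c (suc n))))

replicate-⊆ : ∀ {s t} (x : ℤ) → s ≤ t → replicate s x ⊆ replicate t x
replicate-⊆ {zero}  {zero}  x _         = []
replicate-⊆ {zero}  {suc t} x _         = x ∷ʳ replicate-⊆ x z≤n
replicate-⊆ {suc s} {suc t} x (s≤s s≤t) = refl ∷ replicate-⊆ x s≤t

seqOf-⊆ : ∀ a {c r} n → (∀ j → 1 ≤ j → j ≤ n → c j ≤ r j) → seqOf a c n ⊆ seqOf a r n
seqOf-⊆ a zero    c≤r = []
seqOf-⊆ a (suc n) c≤r =
  SublistP.++⁺ (seqOf-⊆ a n (λ j 1≤j j≤n → c≤r j 1≤j (m≤n⇒m≤1+n j≤n)))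
               (replicate-⊆ (a (suc n)) (c≤r (suc n) (s≤s z≤n) ≤-refl))

sumℤ-nonneg : ∀ {xs} → All (0ℤ ≤ᶻ_) xs → 0ℤ ≤ᶻ sumℤ xs
sumℤ-nonneg []           = ℤP.≤-refl
sumℤ-nonneg (0≤x ∷ xs≥0) = ℤP.+-mono-≤ 0≤x (sumℤ-nonneg xs≥0)

sublist-sum-≤ : ∀ {B A} → All (0ℤ ≤ᶻ_) A → B ⊆ A → sumℤ B ≤ᶻ sumℤ A
sublist-sum-≤ []          []         = ℤP.≤-refl
sublist-sum-≤ {A = y ∷ A} (0≤y ∷ A≥0) (.y ∷ʳ B⊆A) =
  ℤP.≤-trans (sublist-sum-≤ A≥0 B⊆A)
    (subst (_≤ᶻ y +ᶻ sumℤ A) (ℤP.+-identityˡ (sumℤ A)) (ℤP.+-monoˡ-≤ (sumℤ A) 0≤y))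
sublist-sum-≤ {y ∷ B} (_ ∷ A≥0) (refl ∷ B⊆A) = ℤP.+-monoʳ-≤ y (sublist-sum-≤ A≥0 B⊆A)

take-sum-shift : ∀ x xs n → All (x ≤ᶻ_) xs → AllPairs _≤ᶻ_ xs → n ≤ length xs →
                 sumℤ (take n (x ∷ xs)) ≤ᶻ sumℤ (take n xs)
take-sum-shift x xs       zero    _          _                  _         = ℤP.≤-refl
take-sum-shift x (y ∷ ys) (suc n) (x≤y ∷ _) (y≤ys ∷ ys-sorted) (s≤s n≤) =
  ℤP.+-mono-≤ x≤y (take-sum-shift y ys n y≤ys ys-sorted n≤)

prefix-sum-minimal : ∀ {B A} n → AllPairs _≤ᶻ_ A → All (0ℤ ≤ᶻ_) A → B ⊆ A → n ≤ length B →
                     sumℤ (take n A) ≤ᶻ sumℤ B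
prefix-sum-minimal zero    _ A≥0 B⊆A _ = sumℤ-nonneg (All-resp-⊆ B⊆A A≥0)
prefix-sum-minimal (suc n) [] [] [] ()
prefix-sum-minimal {A = y ∷ A} (suc n) (y≤A ∷ A-sorted) (_ ∷ A≥0) (y ∷ʳ B⊆A) n<|B| =
  ℤP.≤-trans (take-sum-shift y A (suc n) y≤A A-sorted
               (≤-trans n<|B| (SublistP.length-mono-≤ B⊆A)))
             (prefix-sum-minimal (suc n) A-sorted A≥0 B⊆A n<|B|)
prefix-sum-minimal {y ∷ B} (suc n) (_ ∷ A-sorted) (_ ∷ A≥0) (refl ∷ B⊆A) (s≤s n≤|B|) =
  ℤP.+-monoʳ-≤ y (prefix-sum-minimal n A-sorted A≥0 B⊆A n≤|B|)

seqOf-All : ∀ {P : ℤ → Set} a r n → (∀ j → 1 ≤ j → j ≤ n → P (a j)) → All P (seqOf a r n)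
seqOf-All a r zero    Pa = []
seqOf-All a r (suc n) Pa =
  AllP.++⁺ (seqOf-All a r n (λ j 1≤j j≤n → Pa j 1≤j (m≤n⇒m≤1+n j≤n)))
           (AllP.replicate⁺ (r (suc n)) (Pa (suc n) (s≤s z≤n) ≤-refl))

replicate-sorted : ∀ t (x : ℤ) → AllPairs _≤ᶻ_ (replicate t x)
replicate-sorted zero    x = []
replicate-sorted (suc t) x = AllP.replicate⁺ t ℤP.≤-refl ∷ replicate-sorted t x

seqOf-sorted : ∀ a r n → (∀ {i j} → i ≤ j → a i ≤ᶻ a j) → AllPairs _≤ᶻ_ (seqOf a r n)
seqOf-sorted a r zero    mono = []
seqOf-sorted a r (suc n) mono =
  AllPairsP.++⁺ (seqOf-sorted a r n mono) (replicate-sorted (r (suc n)) (a (suc n)))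
    (seqOf-All a r n (λ j _ j≤n → AllP.replicate⁺ (r (suc n)) (mono (m≤n⇒m≤1+n j≤n))))

progression : ℕ → ℤ
progression j = + (j ∸ 1)

progression-valid : ∀ k → ValidA k progression
progression-valid k = refl , λ { (suc i) _ _ → ℤ.+<+ ≤-refl }

weight-progression : ∀ c n → weight progression c n ≡ + height n c
weight-progression c zero    = refl
weight-progression c (suc n) = begin
  weight progression c n +ᶻ + c (suc n) *ᶻ + n
    ≡⟨ cong₂ _+ᶻ_ (weight-progression c n) (sym (ℤP.pos-* (c (suc n)) n)) ⟩
  + height n c +ᶻ + (c (suc n) * n)
    ≡⟨ ℤP.pos-+ (height n c) _ ⟨
  + (height n c + c (suc n) * n)
    ≡⟨ cong (λ t → + (height n c + t)) (*-comm (c (suc n)) n) ⟩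
  + height (suc n) c ∎
  where open ≡-Reasoning

x<x+y : ∀ x {y} → 0ℤ <ᶻ y → x <ᶻ x +ᶻ y
x<x+y x 0<y = subst (_<ᶻ x +ᶻ _) (ℤP.+-identityʳ x) (ℤP.+-monoʳ-< x 0<y)

module Walks (k : ℕ) (r : ℕ → ℕ) (α : ℕ) (r≥1 : ∀ i → 1 ≤ i → i ≤ k → 1 ≤ r i) where

  Bounded : Config → Set
  Bounded c = ∀ j → 1 ≤ j → j ≤ k → c j ≤ r j

  Admissible : Config → Set
  Admissible c = Bounded c × α ≤ sumTo c k

  attained : ∀ a {c} → Admissible c → InSigma α (seqOf a r k) (weight a c k)
  attained a {c} (bounded , large) =
      seqOf a c k , seqOf-⊆ a k bounded
    , subst (α ≤_) (sym (length-seqOf a c k)) large , sumℤ-seqOf a c k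

  setAt-bounded : ∀ {c p v} → Bounded c → v ≤ r p → Bounded (setAt c p v)
  setAt-bounded {p = p} bounded v≤rp j 1≤j j≤k with j ≟ p
  ... | yes refl = v≤rp
  ... | no _     = bounded j 1≤j j≤k

  record Step (c c' : Config) : Set where
    field
      admissible   : Admissible c'
      height-suc   : height k c' ≡ suc (height k c)
      weight-grows : ∀ a → ValidA k a → weight a c k <ᶻ weight a c' k

  -- First kind of step: one more copy of a_2 (raises the weight by a_2 > a_1 = 0).
  raise-second : ∀ {c} → Admissible c → 2 ≤ k → c 2 < r 2 → Step c (raise c 2)
  raise-second {c} (bounded , large) 2≤k c₂<r₂ = record
    { admissible   = setAt-bounded bounded c₂<r₂
                   , ≤-trans large (subst (sumTo c k ≤_) (sym (size-bump 1≤2 2≤k bumps)) (m≤m+n _ 1))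
    ; height-suc   = trans (height-bump 1≤2 2≤k bumps) (+-comm _ 1)
    ; weight-grows = λ a valid → subst (weight a c k <ᶻ_) (sym (weight-bump a 1≤2 2≤k bumps))
                                       (x<x+y (weight a c k) (second-positive a valid))
    }
    where
    1≤2 : 1 ≤ 2
    1≤2 = s≤s z≤n
    bumps : Bumped 2 c (raise c 2)
    bumps = raise-bumps c 2
    second-positive : ∀ a → ValidA k a → 0ℤ <ᶻ a 2
    second-positive a (a₁≡0 , increasing) = subst (_<ᶻ a 2) a₁≡0 (increasing 1 ≤-refl 2≤k)

  -- Second kind of step: move one copy from a saturated index p (which holds at least
  -- r_p ≥ 1 copies) to p + 1; the weight rises by a_{p+1} - a_p > 0.
  shift-up : ∀ {c p} → Admissible c → 1 ≤ p → p < k → r p ≤ c p → c (suc p) < r (suc p) →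
             Step c (raise (lower c p) (suc p))
  shift-up {c} {suc q} (bounded , large) 1≤p@(s≤s z≤n) p<k saturated deficient = record
    { admissible   = setAt-bounded (setAt-bounded bounded (≤-trans pred[n]≤n (bounded p 1≤p p≤k)))
                                   (subst (λ v → suc v ≤ r (suc p)) (sym unchanged) deficient)
                   , subst (α ≤_) (sym same-size) large
    ; height-suc   = begin
        height k c'            ≡⟨ height-bump (s≤s z≤n) p<k up ⟩
        height k c₋ + suc q    ≡⟨ +-suc _ q ⟩
        suc (height k c₋ + q)  ≡⟨ cong suc (height-bump 1≤p p≤k down) ⟨
        suc (height k c)       ∎
    ; weight-grows = λ { a (_ , increasing) →
        subst₂ _<ᶻ_ (sym (weight-bump a 1≤p p≤k down)) (sym (weight-bump a (s≤s z≤n) p<k up))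
               (ℤP.+-monoʳ-< (weight a c₋ k) (increasing p 1≤p p<k)) }
    }
    where
    open ≡-Reasoning
    p : ℕ
    p = suc q
    c₋ c' : Config
    c₋ = lower c p
    c' = raise c₋ (suc p)
    p≤k : p ≤ k
    p≤k = <⇒≤ p<k
    down : Bumped p c₋ c
    down = lower-bumps c p (≤-trans (r≥1 p 1≤p p≤k) saturated)
    up : Bumped (suc p) c₋ c'
    up = raise-bumps c₋ (suc p)
    unchanged : c₋ (suc p) ≡ c (suc p)
    unchanged = setAt-elsewhere c _ 1+n≢n
    same-size : sumTo c' k ≡ sumTo c k
    same-size = trans (size-bump (s≤s z≤n) p<k up) (sym (size-bump 1≤p p≤k down))

  LeastDeficient : Config → ℕ → ℕ → Set
  LeastDeficient c n i = 2 ≤ i × i ≤ n × c i < r i × (∀ j → 2 ≤ j → j < i → r j ≤ c j)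

  scan : ∀ c n → (∀ j → 2 ≤ j → j ≤ n → r j ≤ c j) ⊎ Σ ℕ (LeastDeficient c n)
  scan c zero = inj₁ λ { j (s≤s _) () }
  scan c (suc n) with scan c n
  ... | inj₂ (i , 2≤i , i≤n , deficient , least) = inj₂ (i , 2≤i , m≤n⇒m≤1+n i≤n , deficient , least)
  ... | inj₁ saturated with r (suc n) ≤? c (suc n) | 2 ≤? suc n
  ...   | yes last-saturated | _ = inj₁ λ j 2≤j j≤1+n → case m≤n⇒m<n∨m≡n j≤1+n of λ
            { (inj₁ j<1+n) → saturated j 2≤j (≤-pred j<1+n)
            ; (inj₂ refl)  → last-saturated }
  ...   | no deficient | yes 2≤1+n =
            inj₂ (suc n , 2≤1+n , ≤-refl , ≰⇒> deficient , λ j 2≤j j<1+n → saturated j 2≤j (≤-pred j<1+n))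
  ...   | no _ | no 2≰1+n = inj₁ λ j 2≤j j≤1+n → ⊥-elim (2≰1+n (≤-trans 2≤j j≤1+n))

  -- Below the height of r̄ itself a step is always possible: if every c j (j ≥ 2) were
  -- saturated, the height of c would be at least that of r̄.
  step : ∀ {c} → Admissible c → height k c < height k r → Σ Config (Step c)
  step {c} admissible below with scan c k
  ... | inj₁ saturated = ⊥-elim (<⇒≱ below (sumTo-mono k dominated))
    where
    dominated : ∀ j → 1 ≤ j → j ≤ k → (j ∸ 1) * r j ≤ (j ∸ 1) * c j
    dominated (suc zero)    _ _   = z≤n
    dominated (suc (suc j)) _ j≤k = *-monoʳ-≤ (suc j) (saturated (suc (suc j)) (s≤s (s≤s z≤n)) j≤k)
  ... | inj₂ (suc zero , s≤s () , _)
  ... | inj₂ (suc (suc zero) , _ , 2≤k , deficient , _) =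
    raise c 2 , raise-second admissible 2≤k deficient
  ... | inj₂ (suc (suc (suc q)) , _ , i≤k , deficient , least) =
    _ , shift-up admissible (s≤s z≤n) i≤k (least (suc (suc q)) (s≤s (s≤s z≤n)) ≤-refl) deficient

  data Walk : Config → ℕ → Set where
    stop   : ∀ {c} → Walk c 0
    _then_ : ∀ {c c' d} → Step c c' → Walk c' d → Walk c (suc d)

  walk : ∀ d {c} → Admissible c → height k c + d ≡ height k r → Walk c d
  walk zero        _          _     = stop
  walk (suc d) {c} admissible reach with step admissible (subst (height k c <_) reach (m<m+n _ (s≤s z≤n)))
  ... | _ , s = s then walk d (Step.admissible s)
                         (trans (cong (_+ d) (Step.height-suc s)) (trans (sym (+-suc _ d)) reach))

  weights : (ℕ → ℤ) → ∀ {c d} → Walk c d → List ℤ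
  weights a {c} stop       = weight a c k ∷ []
  weights a {c} (_ then w) = weight a c k ∷ weights a w

  length-weights : ∀ a {c d} (w : Walk c d) → length (weights a w) ≡ suc d
  length-weights a stop       = refl
  length-weights a (_ then w) = cong suc (length-weights a w)

  weights-attained : ∀ a {c d} → Admissible c → (w : Walk c d) → All (InSigma α (seqOf a r k)) (weights a w)
  weights-attained a admissible stop       = attained a admissible ∷ []
  weights-attained a admissible (s then w) = attained a admissible ∷ weights-attained a (Step.admissible s) w

  weights-above : ∀ a → ValidA k a → ∀ {c d} (w : Walk c d) → All (weight a c k ≤ᶻ_) (weights a w)
  weights-above a valid stop       = ℤP.≤-refl ∷ []
  weights-above a valid (s then w) =
    ℤP.≤-refl ∷ All.map (ℤP.≤-trans (ℤP.<⇒≤ (Step.weight-grows s a valid))) (weights-above a valid w)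

  weights-distinct : ∀ a → ValidA k a → ∀ {c d} (w : Walk c d) → Unique (weights a w)
  weights-distinct a valid stop       = [] ∷ []
  weights-distinct a valid (s then w) =
      All.map (λ above → ℤP.<⇒≢ (ℤP.<-≤-trans (Step.weight-grows s a valid) above)) (weights-above a valid w)
    ∷ weights-distinct a valid w

  -- For the progression the weights are the heights, which go up one by one: a walk
  -- of d steps from c meets every integer in [height c, height c + d].
  weights-cover : ∀ {c d} (w : Walk c d) s → height k c ≤ s → s ≤ height k c + d →
                  + s ∈ weights progression w
  weights-cover {c} stop s low high =
    here (trans (cong +_ (≤-antisym (subst (s ≤_) (+-identityʳ _) high) low)) (sym (weight-progression c k)))
  weights-cover {c} {suc d} (st then w) s low high with s ≟ height k c
  ... | yes refl = here (sym (weight-progression c k))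
  ... | no s≢h   = there (weights-cover w s
                     (subst (_≤ s) (sym (Step.height-suc st)) (≤∧≢⇒< low (≢-sym s≢h)))
                     (subst (s ≤_) (trans (+-suc _ d) (cong (_+ d) (sym (Step.height-suc st)))) high))

take-length-++ : ∀ (xs ys : List ℤ) → take (length xs) (xs ++ ys) ≡ xs
take-length-++ []       ys = refl
take-length-++ (x ∷ xs) ys = cong (x ∷_) (take-length-++ xs ys)

replicate-+ : ∀ s t (x : ℤ) → replicate (s + t) x ≡ replicate s x ++ replicate t x
replicate-+ zero    t x = refl
replicate-+ (suc s) t x = cong (x ∷_) (replicate-+ s t x)

seqOf-prefix : ∀ a r {m n} → m ≤ n → Σ (List ℤ) λ rest → seqOf a r n ≡ seqOf a r m ++ rest
seqOf-prefix a r {n = zero}  z≤n = [] , refl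
seqOf-prefix a r {m} {suc n} m≤1+n with m≤n⇒m<n∨m≡n m≤1+n
... | inj₂ refl        = [] , sym (ListP.++-identityʳ _)
... | inj₁ (s≤s m≤n) with seqOf-prefix a r m≤n
...   | rest , split = rest ++ replicate (r (suc n)) (a (suc n))
                     , trans (cong (_++ replicate (r (suc n)) (a (suc n))) split) (ListP.++-assoc (seqOf a r m) rest _)

module Corollary (k : ℕ) (r : ℕ → ℕ) (α : ℕ) (r≥1 : ∀ i → 1 ≤ i → i ≤ k → 1 ≤ r i) where
  open Walks k r α r≥1

  locate : ∀ n → α < sumTo r n → Σ ℕ λ m → (1 ≤ m × m ≤ n) × (sumTo r (m ∸ 1) ≤ α × α < sumTo r m)
  locate zero ()
  locate (suc n) α<S with α <? sumTo r n
  ... | yes α<S' = let m , (1≤m , m≤n) , found = locate n α<S' in m , (1≤m , m≤n⇒m≤1+n m≤n) , found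
  ... | no α≮S'  = suc n , (s≤s z≤n , ≤-refl) , ≮⇒≥ α≮S' , α<S

  module Block (m' : ℕ) (m≤k : suc m' ≤ k) (lo : sumTo r m' ≤ α) (hi : α < sumTo r (suc m')) where

    u : ℕ
    u = α ∸ sumTo r m'

    α-split : sumTo r m' + u ≡ α
    α-split = m+[n∸m]≡n lo

    u<r : u < r (suc m')
    u<r = +-cancelˡ-< (sumTo r m') u (r (suc m')) (subst (_< sumTo r (suc m')) (sym α-split) hi)

    -- The configuration of the first α terms: all copies of a_1..a_{m'}, u copies of a_m.
    initial : Config
    initial j with j ≤? m' | j ≟ suc m'
    ... | yes _ | _     = r j
    ... | no _  | yes _ = u
    ... | no _  | no _  = 0

    initial-below : ∀ j → j ≤ m' → initial j ≡ r j
    initial-below j j≤m' with j ≤? m'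
    ... | yes _   = refl
    ... | no j≰m' = ⊥-elim (j≰m' j≤m')

    initial-at : initial (suc m') ≡ u
    initial-at with suc m' ≤? m' | suc m' ≟ suc m'
    ... | yes m<m' | _  = ⊥-elim (1+n≰n m<m')
    ... | no _  | yes _ = refl
    ... | no _  | no ne = ⊥-elim (ne refl)

    initial-above : ∀ j → suc m' < j → initial j ≡ 0
    initial-above j m<j with j ≤? m' | j ≟ suc m'
    ... | yes j≤m' | _      = ⊥-elim (<⇒≱ m<j (m≤n⇒m≤1+n j≤m'))
    ... | no _     | yes eq = ⊥-elim (<⇒≢ m<j (sym eq))
    ... | no _     | no _   = refl

    initial-admissible : Admissible initial
    initial-admissible = bounded , ≤-reflexive (sym size)
      where
      bounded : Bounded initial
      bounded j _ _ with j ≤? m' | j ≟ suc m'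
      ... | yes _ | _        = ≤-refl
      ... | no _  | yes refl = <⇒≤ u<r
      ... | no _  | no _     = z≤n
      size : sumTo initial k ≡ α
      size = trans (sumTo-tail initial initial-above m≤k)
                   (trans (cong₂ _+_ (sumTo-cong m' (λ j _ → initial-below j)) initial-at) α-split)

    initial-height : height k initial ≡ height m' r + m' * u
    initial-height =
      trans (sumTo-tail _ (λ j m<j → trans (cong ((j ∸ 1) *_) (initial-above j m<j)) (*-zeroʳ (j ∸ 1))) m≤k)
            (cong₂ _+_ (sumTo-cong m' (λ j _ j≤m' → cong ((j ∸ 1) *_) (initial-below j j≤m')))
                       (cong (m' *_) initial-at))

    steps : ℕ
    steps = (height k r ∸ height (suc m') r) + m' * (sumTo r (suc m') ∸ α)

    bound≡ : suc steps ≡ bound k r α (suc m')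
    bound≡ = +-comm 1 steps

    reach : height k initial + steps ≡ height k r
    reach = begin
      height k initial + steps
        ≡⟨ cong₂ _+_ initial-height (cong (λ t → rest + m' * t) remaining) ⟩
      (height m' r + m' * u) + (rest + m' * (r (suc m') ∸ u))
        ≡⟨ solve 4 (λ h x y z → (h :+ x) :+ (y :+ z) := (h :+ (x :+ z)) :+ y) refl
                 (height m' r) (m' * u) rest (m' * (r (suc m') ∸ u)) ⟩
      (height m' r + (m' * u + m' * (r (suc m') ∸ u))) + rest
        ≡⟨ cong (λ t → height m' r + t + rest)
                (trans (sym (*-distribˡ-+ m' u _)) (cong (m' *_) (m+[n∸m]≡n (<⇒≤ u<r)))) ⟩
      height (suc m') r + rest
        ≡⟨ m+[n∸m]≡n (sumTo-≤ _ m≤k) ⟩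
      height k r ∎
      where
      open ≡-Reasoning
      open +-*-Solver
      rest : ℕ
      rest = height k r ∸ height (suc m') r
      remaining : sumTo r (suc m') ∸ α ≡ r (suc m') ∸ u
      remaining = trans (cong (sumTo r (suc m') ∸_) (sym α-split)) ([m+n]∸[m+o]≡n∸o (sumTo r m') _ u)

    the-walk : Walk initial steps
    the-walk = walk steps initial-admissible reach

    lower-bound : ∀ a → ValidA k a → CardAtLeast (InSigma α (seqOf a r k)) (bound k r α (suc m'))
    lower-bound a valid =
        weights a the-walk , weights-distinct a valid the-walk
      , trans (length-weights a the-walk) bound≡ , weights-attained a initial-admissible the-walk

    first-α : ∀ a → take α (seqOf a r k) ≡ seqOf a r m' ++ replicate u (a (suc m'))
    first-α a with seqOf-prefix a r m≤k
    ... | rest , split = begin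
      take α (seqOf a r k)
        ≡⟨ cong (take α) split ⟩
      take α ((seqOf a r m' ++ replicate (r (suc m')) x) ++ rest)
        ≡⟨ cong (λ t → take α ((seqOf a r m' ++ t) ++ rest))
                (trans (cong (λ t → replicate t x) (sym (m+[n∸m]≡n (<⇒≤ u<r)))) (replicate-+ u _ x)) ⟩
      take α ((seqOf a r m' ++ (replicate u x ++ replicate (r (suc m') ∸ u) x)) ++ rest)
        ≡⟨ cong (take α) (regroup (seqOf a r m') (replicate u x) _ rest) ⟩
      take α (prefix ++ suffix)
        ≡⟨ cong (λ t → take t (prefix ++ suffix)) (sym prefix-length) ⟩
      take (length prefix) (prefix ++ suffix)
        ≡⟨ take-length-++ prefix suffix ⟩
      prefix ∎
      where
      open ≡-Reasoning
      x : ℤ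
      x = a (suc m')
      prefix : List ℤ
      prefix = seqOf a r m' ++ replicate u x
      suffix : List ℤ
      suffix = replicate (r (suc m') ∸ u) x ++ rest
      regroup : ∀ (p q s t : List ℤ) → (p ++ (q ++ s)) ++ t ≡ (p ++ q) ++ (s ++ t)
      regroup p q s t = trans (ListP.++-assoc p (q ++ s) t)
                              (trans (cong (p ++_) (ListP.++-assoc q s t)) (sym (ListP.++-assoc p q (s ++ t))))
      prefix-length : length prefix ≡ α
      prefix-length = trans (ListP.length-++ (seqOf a r m'))
                            (trans (cong₂ _+_ (length-seqOf a r m') (ListP.length-replicate u)) α-split)

    first-α-sum : sumℤ (take α (seqOf progression r k)) ≡ + height k initial
    first-α-sum = begin
      sumℤ (take α (seqOf progression r k))
        ≡⟨ cong sumℤ (first-α progression) ⟩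
      sumℤ (seqOf progression r m' ++ replicate u (+ m'))
        ≡⟨ sumℤ-++ (seqOf progression r m') _ ⟩
      sumℤ (seqOf progression r m') +ᶻ sumℤ (replicate u (+ m'))
        ≡⟨ cong₂ _+ᶻ_ (trans (sumℤ-seqOf progression r m') (weight-progression r m'))
                      (trans (sumℤ-replicate u (+ m')) (sym (ℤP.pos-* u m'))) ⟩
      + height m' r +ᶻ + (u * m')
        ≡⟨ ℤP.pos-+ (height m' r) _ ⟨
      + (height m' r + u * m')
        ≡⟨ cong (λ t → + (height m' r + t)) (*-comm u m') ⟩
      + (height m' r + m' * u)
        ≡⟨ cong +_ initial-height ⟨
      + height k initial ∎
      where open ≡-Reasoning

    -- For a_j = j - 1 every element of Σ_α lies between the initial height (a subsequence
    -- with ≥ α terms sums to at least the first α terms) and the height of r̄ (the total).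
    sums-between : ∀ {s} → InSigma α (seqOf progression r k) s →
                   + height k initial ≤ᶻ s × s ≤ᶻ + height k r
    sums-between (B , B⊆A , α≤|B| , sumB≡s) =
        subst₂ _≤ᶻ_ first-α-sum sumB≡s (prefix-sum-minimal α sorted nonneg B⊆A α≤|B|)
      , subst₂ _≤ᶻ_ sumB≡s total (sublist-sum-≤ nonneg B⊆A)
      where
      sorted : AllPairs _≤ᶻ_ (seqOf progression r k)
      sorted = seqOf-sorted progression r k (λ i≤j → ℤ.+≤+ (∸-monoˡ-≤ 1 i≤j))
      nonneg : All (0ℤ ≤ᶻ_) (seqOf progression r k)
      nonneg = seqOf-All progression r k (λ _ _ _ → ℤ.+≤+ z≤n)
      total : sumℤ (seqOf progression r k) ≡ + height k r
      total = trans (sumℤ-seqOf progression r k) (weight-progression r k)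

    extremal : Σ (ℕ → ℤ) λ a → ValidA k a × CardEq (InSigma α (seqOf a r k)) (bound k r α (suc m'))
    extremal =
        progression , progression-valid k
      , weights progression the-walk , weights-distinct progression (progression-valid k) the-walk
      , trans (length-weights progression the-walk) bound≡
      , weights-attained progression initial-admissible the-walk , complete
      where
      complete : ∀ s → InSigma α (seqOf progression r k) s → s ∈ weights progression the-walk
      complete s inΣ with sums-between inΣ
      ... | ℤ.+≤+ low , ℤ.+≤+ high = weights-cover the-walk _ low (subst (_ ≤_) (sym reach) high)

  -- Since r_1 ≥ 1, the hypothesis α ≤ |A| - 1 says α < |A|.
  α<length : 1 ≤ k → α ≤ sumTo r k ∸ 1 → α < sumTo r k
  α<length 1≤k α≤S∸1 = m≤pred[n]⇒suc[m]≤n {{>-nonZero 1≤S}} α≤S∸1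
    where
    1≤S : 1 ≤ sumTo r k
    1≤S = ≤-trans (r≥1 1 ≤-refl 1≤k) (sumTo-≤ r 1≤k)

corollary3p2 : (k : ℕ) → (r : ℕ → ℕ) → (α : ℕ) →
    2 ≤ k →
    (∀ i → 1 ≤ i → i ≤ k → 1 ≤ r i) →
    α ≤ sumTo r k ∸ 1 →
    Σ ℕ λ m → (1 ≤ m × m ≤ k) × (sumTo r (m ∸ 1) ≤ α × α < sumTo r m)
      × ((a : ℕ → ℤ) → ValidA k a →
           CardAtLeast (InSigma α (seqOf a r k)) (bound k r α m))
      × (Σ (ℕ → ℤ) λ a → ValidA k a ×
           CardEq (InSigma α (seqOf a r k)) (bound k r α m))
corollary3p2 k r α 2≤k r≥1 α≤S∸1
  with Corollary.locate k r α r≥1 k (Corollary.α<length k r α r≥1 (≤-trans (s≤s z≤n) 2≤k) α≤S∸1)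
... | suc m' , (1≤m , m≤k) , (lo , hi) = suc m' , (1≤m , m≤k) , (lo , hi) , lower-bound , extremal
  where open Corollary.Block k r α r≥1 m' m≤k lo hi
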